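{- For every integer $k\ge 0$, let $A_k(z)=\sum_{P} z^{|P|}$, where the sum runs over all skew Dyck paths $P$ that start at level $0$, end at level $k$, and contain no contiguous occurrence of the three steps up--down--left, and $|P|$ denotes the number of steps of $P$. Let $u_1$ be the solution of the algebraic equation $$-u^2+zu^3+2zu-u^2z^2-uz^3-z^4=0$$ whose expansion around $z=0$ is $u_1=\frac1z-z-z^3-2z^5-6z^7-20z^9-71z^{11}-262z^{13}-\cdots$. Then $$A_k(z)=\frac{1-zu_1}{z^2u_1^{k}}.$$
   Context: A skew Dyck path is a finite lattice path in the plane starting at $(0,0)$, using up steps $U=(1,1)$, down steps $D=(1,-1)$ and left steps $L=(-1,-1)$, never going below the line $y=0$, and never overlapping itself; equivalently, the contiguous pairs $UL$ and $LU$ never occur. The level of a point is its $y$-coordinate; a path ends at level $k$ if its final point has $y$-coordinate $k$ (the $x$-coordinate of the endpoint is arbitrary). "Up--down--left" is the contiguous pattern $UDL$. -}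

module Defs where

open import Data.Nat using (ℕ; zero; suc; _∸_)
open import Data.Integer using (ℤ; 0ℤ; 1ℤ; +_; -_) renaming (_+_ to _+ℤ_; _*_ to _*ℤ_)
open import Data.Bool using (Bool; true; false; _∧_; not)
open import Data.List using (List; []; _∷_; length; filter; concatMap)
open import Data.Nat using (_≡ᵇ_)
open import Relation.Binary.PropositionalEquality using (_≡_)
open import Relation.Nullary.Decidable using (Dec; yes; no)
open import Data.Bool using (T)
open import Data.Bool.Properties using (T?)

data Step : Set where
  U D L : Step

stays≥0 : ℕ → List Step → Bool
stays≥0 h [] = true
stays≥0 h (U ∷ s) = stays≥0 (suc h) s
stays≥0 zero (D ∷ s) = false
stays≥0 (suc h) (D ∷ s) = stays≥0 h s
stays≥0 zero (L ∷ s) = false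
stays≥0 (suc h) (L ∷ s) = stays≥0 h s

-- final level of a path started at level h (only meaningful when stays≥0 h s)
endLevel : ℕ → List Step → ℕ
endLevel h [] = h
endLevel h (U ∷ s) = endLevel (suc h) s
endLevel h (D ∷ s) = endLevel (h ∸ 1) s
endLevel h (L ∷ s) = endLevel (h ∸ 1) s

-- no contiguous UL and no contiguous LU (non-self-overlapping)
noULLU : List Step → Bool
noULLU (U ∷ L ∷ s) = false
noULLU (L ∷ U ∷ s) = false
noULLU [] = true
noULLU (x ∷ s) = noULLU s

noUDL : List Step → Bool
noUDL (U ∷ D ∷ L ∷ s) = false
noUDL [] = true
noUDL (x ∷ s) = noUDL s

isSkewDyck : List Step → Bool
isSkewDyck s = stays≥0 0 s ∧ noULLU s

words : ℕ → List (List Step)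
words zero = [] ∷ []
words (suc n) = concatMap (λ w → (U ∷ w) ∷ (D ∷ w) ∷ (L ∷ w) ∷ []) (words n)

a : ℕ → ℕ → ℕ
a k n = length (filter (λ s → T? (isSkewDyck s ∧ noUDL s ∧ (endLevel 0 s ≡ᵇ k))) (words n))

FPS : Set
FPS = ℕ → ℤ

sumUpTo : (ℕ → ℤ) → ℕ → ℤ
sumUpTo f zero = f 0
sumUpTo f (suc n) = sumUpTo f n +ℤ f (suc n)

_⊕_ : FPS → FPS → FPS
(f ⊕ g) n = f n +ℤ g n

⊝_ : FPS → FPS
(⊝ f) n = - f n

_⊛_ : FPS → FPS → FPS
(f ⊛ g) n = sumUpTo (λ i → f i *ℤ g (n ∸ i)) n

infixl 6 _⊕_
infixl 7 _⊛_

zeroS : FPS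
zeroS _ = 0ℤ

oneS : FPS
oneS zero = 1ℤ
oneS (suc _) = 0ℤ

zpow : ℕ → FPS
zpow k n with n ≡ᵇ k
... | true = 1ℤ
... | false = 0ℤ

_^S_ : FPS → ℕ → FPS
f ^S zero = oneS
f ^S suc k = f ⊛ (f ^S k)

_≈S_ : FPS → FPS → Set
f ≈S g = ∀ n → f n ≡ g n

A : ℕ → FPS
A k n = + a k n

-- u₁ is encoded by w = z·u₁, a power series with w(0) = 1.
-- Substituting u = w/z into  -u^2 + z u^3 + 2 z u - u^2 z^2 - u z^3 - z^4 = 0
-- and multiplying by z^2 gives
--   -w^2 + w^3 + 2 z^2 w - z^2 w^2 - z^4 w - z^6 = 0 .

cubicW : FPS → FPS
cubicW w =
  ⊝ (w ^S 2) ⊕ (w ^S 3) ⊕ (zpow 2 ⊛ w) ⊕ (zpow 2 ⊛ w)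
  ⊕ ⊝ (zpow 2 ⊛ (w ^S 2)) ⊕ ⊝ (zpow 4 ⊛ w) ⊕ ⊝ (zpow 6)

{-# OPTIONS --safe #-}

-- Reading a path from left to right, one only needs to remember its level and
-- which suffix (U, UD, L, or none of these) could still grow into a forbidden
-- factor UL, LU or UDL.  Grouping paths by this final configuration (s , k), the
-- generating functions satisfy the linear equations
--   F (s , k) = [(s , k) is the start] + z · Σ F p   (p one step before (s , k)),
-- which determine them coefficient by coefficient.  With y = 1/w, v = z y = 1/u₁,
-- c = z v and d = y − 1 − c, the family v^k · (1, c, d, d − c²) in the four
-- contexts, corrected by ∓1 at level 0 in the first and the third, solves them
-- because d = c (c + 2d − c²), which is the cubic for w rewritten in terms of y.
-- Summing over the contexts gives A_k = v^k (1 + c + 2d − c²); finally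
-- z² (1 + c + 2d − c²) = 1 − w, again by the cubic, and w^k v^k = z^k.

module Submission where

open import Defs
open import Data.Nat using (ℕ; zero; suc; _+_; _∸_; _≤_; z≤n; s≤s; _≡ᵇ_)
open import Data.Nat.Properties as ℕ using ()
open import Data.Integer as ℤ using (ℤ; 0ℤ; 1ℤ; +0; +[1+_]; -[1+_]) renaming (_+_ to _+ℤ_; _*_ to _*ℤ_)
import Data.Integer.Properties as ℤ
open import Data.Integer.Tactic.RingSolver using (solve-∀)
import Data.Nat.Tactic.RingSolver as ℕ-Solver
open import Data.Product using (_×_; _,_)
open import Data.Maybe using (Maybe; just; nothing)
open import Data.Bool using (Bool; true; false; _∧_)
open import Data.Bool.Properties using (∧-zeroʳ; T?)
open import Data.List using (List; []; _∷_; _∷ʳ_; _++_; map; foldr; filter; length; concatMap)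
open import Data.Nat.ListAction using (sum)
open import Relation.Nullary using (yes; no)
open import Relation.Binary.PropositionalEquality
  using (_≡_; refl; sym; trans; cong; cong₂; module ≡-Reasoning)
open import Relation.Binary.Structures using (IsEquivalence)
open import Level using (0ℓ)
open import Algebra.Bundles using (CommutativeRing)
open import Algebra.Structures {A = FPS} _≈S_ using (IsCommutativeRing)
open import Algebra.Solver.Ring.AlmostCommutativeRing
  using (fromCommutativeRing; _-Raw-AlmostCommutative⟶_)
import Algebra.Solver.Ring as RingSolver
open import Algebra.Properties.CommutativeSemigroup ℤ.+-commutativeSemigroup
  using () renaming (interchange to ℤ-+-interchange)
open import Algebra.Properties.CommutativeSemigroup ℕ.+-commutativeSemigroup
  using () renaming (interchange to ℕ-+-interchange)

sumUpTo-cong-≤ : ∀ {F G : ℕ → ℤ} n → (∀ i → i ≤ n → F i ≡ G i) → sumUpTo F n ≡ sumUpTo G n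
sumUpTo-cong-≤ zero    F≡G = F≡G 0 z≤n
sumUpTo-cong-≤ (suc n) F≡G =
  cong₂ _+ℤ_ (sumUpTo-cong-≤ n (λ i i≤n → F≡G i (ℕ.m≤n⇒m≤1+n i≤n))) (F≡G (suc n) ℕ.≤-refl)

sumUpTo-cong : ∀ {F G : ℕ → ℤ} n → (∀ i → F i ≡ G i) → sumUpTo F n ≡ sumUpTo G n
sumUpTo-cong n F≡G = sumUpTo-cong-≤ n (λ i _ → F≡G i)

sumUpTo-suc : ∀ (F : ℕ → ℤ) n → sumUpTo F (suc n) ≡ F 0 +ℤ sumUpTo (λ i → F (suc i)) n
sumUpTo-suc F zero    = refl
sumUpTo-suc F (suc n) = trans (cong (_+ℤ F (suc (suc n))) (sumUpTo-suc F n))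
  (ℤ.+-assoc (F 0) (sumUpTo (λ i → F (suc i)) n) (F (suc (suc n))))

sumUpTo-+ : ∀ (F G : ℕ → ℤ) n → sumUpTo (λ i → F i +ℤ G i) n ≡ sumUpTo F n +ℤ sumUpTo G n
sumUpTo-+ F G zero    = refl
sumUpTo-+ F G (suc n) = trans (cong (_+ℤ (F (suc n) +ℤ G (suc n))) (sumUpTo-+ F G n))
  (ℤ-+-interchange (sumUpTo F n) (sumUpTo G n) (F (suc n)) (G (suc n)))

sumUpTo-*ˡ : ∀ c (F : ℕ → ℤ) n → sumUpTo (λ i → c *ℤ F i) n ≡ c *ℤ sumUpTo F n
sumUpTo-*ˡ c F zero    = refl
sumUpTo-*ˡ c F (suc n) = trans (cong (_+ℤ c *ℤ F (suc n)) (sumUpTo-*ˡ c F n))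
  (sym (ℤ.*-distribˡ-+ c (sumUpTo F n) (F (suc n))))

sumUpTo-zero : ∀ (F : ℕ → ℤ) n → (∀ i → F i ≡ 0ℤ) → sumUpTo F n ≡ 0ℤ
sumUpTo-zero F zero    F≡0 = F≡0 0
sumUpTo-zero F (suc n) F≡0 = cong₂ _+ℤ_ (sumUpTo-zero F n F≡0) (F≡0 (suc n))

-- The ring of formal power series

shift : FPS → FPS
shift f n = f (suc n)

infixr 8 _•_

_•_ : ℤ → FPS → FPS
(c • f) n = c *ℤ f n

⊛-suc : ∀ f g n → (f ⊛ g) (suc n) ≡ f 0 *ℤ g (suc n) +ℤ (shift f ⊛ g) n
⊛-suc f g n = sumUpTo-suc (λ i → f i *ℤ g (suc n ∸ i)) n

⊛-sucʳ : ∀ f g n → (f ⊛ g) (suc n) ≡ (f ⊛ shift g) n +ℤ f (suc n) *ℤ g 0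
⊛-sucʳ f g n = cong₂ _+ℤ_
  (sumUpTo-cong-≤ n (λ i i≤n → cong (λ m → f i *ℤ g m) (ℕ.+-∸-assoc 1 i≤n)))
  (cong (λ m → f (suc n) *ℤ g m) (ℕ.n∸n≡0 n))

⊛-cong : ∀ {f f′ g g′} → f ≈S f′ → g ≈S g′ → (f ⊛ g) ≈S (f′ ⊛ g′)
⊛-cong f≈f′ g≈g′ n = sumUpTo-cong n (λ i → cong₂ _*ℤ_ (f≈f′ i) (g≈g′ (n ∸ i)))

⊛-comm : ∀ f g → (f ⊛ g) ≈S (g ⊛ f)
⊛-comm f g zero    = ℤ.*-comm (f 0) (g 0)
⊛-comm f g (suc n) = begin
  (f ⊛ g) (suc n)                       ≡⟨ ⊛-sucʳ f g n ⟩
  (f ⊛ shift g) n +ℤ f (suc n) *ℤ g 0   ≡⟨ cong₂ _+ℤ_ (⊛-comm f (shift g) n) (ℤ.*-comm (f (suc n)) (g 0)) ⟩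
  (shift g ⊛ f) n +ℤ g 0 *ℤ f (suc n)   ≡⟨ ℤ.+-comm ((shift g ⊛ f) n) _ ⟩
  g 0 *ℤ f (suc n) +ℤ (shift g ⊛ f) n   ≡⟨ ⊛-suc g f n ⟨
  (g ⊛ f) (suc n)                       ∎
  where open ≡-Reasoning

⊛-distribʳ : ∀ h f g → ((f ⊕ g) ⊛ h) ≈S (f ⊛ h ⊕ g ⊛ h)
⊛-distribʳ h f g n = trans (sumUpTo-cong n (λ i → ℤ.*-distribʳ-+ (h (n ∸ i)) (f i) (g i)))
  (sumUpTo-+ (λ i → f i *ℤ h (n ∸ i)) (λ i → g i *ℤ h (n ∸ i)) n)

•-⊛ : ∀ c f g → ((c • f) ⊛ g) ≈S (c • (f ⊛ g))
•-⊛ c f g n = trans (sumUpTo-cong n (λ i → ℤ.*-assoc c (f i) (g (n ∸ i))))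
  (sumUpTo-*ˡ c (λ i → f i *ℤ g (n ∸ i)) n)

shift-⊛ : ∀ f g → shift (f ⊛ g) ≈S (f 0 • shift g ⊕ shift f ⊛ g)
shift-⊛ f g = ⊛-suc f g

⊛-assoc : ∀ f g h → ((f ⊛ g) ⊛ h) ≈S (f ⊛ (g ⊛ h))
⊛-assoc f g h zero    = ℤ.*-assoc (f 0) (g 0) (h 0)
⊛-assoc f g h (suc n) = begin
  ((f ⊛ g) ⊛ h) (suc n)
    ≡⟨ ⊛-suc (f ⊛ g) h n ⟩
  (f 0 *ℤ g 0) *ℤ h (suc n) +ℤ (shift (f ⊛ g) ⊛ h) n
    ≡⟨ cong ((f 0 *ℤ g 0) *ℤ h (suc n) +ℤ_) shifted ⟩
  (f 0 *ℤ g 0) *ℤ h (suc n) +ℤ (f 0 *ℤ (shift g ⊛ h) n +ℤ (shift f ⊛ (g ⊛ h)) n)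
    ≡⟨ regroup (f 0) (g 0) (h (suc n)) _ _ ⟩
  f 0 *ℤ (g 0 *ℤ h (suc n) +ℤ (shift g ⊛ h) n) +ℤ (shift f ⊛ (g ⊛ h)) n
    ≡⟨ cong (λ x → f 0 *ℤ x +ℤ (shift f ⊛ (g ⊛ h)) n) (⊛-suc g h n) ⟨
  f 0 *ℤ (g ⊛ h) (suc n) +ℤ (shift f ⊛ (g ⊛ h)) n
    ≡⟨ ⊛-suc f (g ⊛ h) n ⟨
  (f ⊛ (g ⊛ h)) (suc n) ∎
  where
  open ≡-Reasoning
  shifted : (shift (f ⊛ g) ⊛ h) n ≡ f 0 *ℤ (shift g ⊛ h) n +ℤ (shift f ⊛ (g ⊛ h)) n
  shifted = trans (⊛-cong {g = h} (shift-⊛ f g) (λ _ → refl) n)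
    (trans (⊛-distribʳ h (f 0 • shift g) (shift f ⊛ g) n)
      (cong₂ _+ℤ_ (•-⊛ (f 0) (shift g) h n) (⊛-assoc (shift f) g h n)))
  regroup : ∀ a b c d e → (a *ℤ b) *ℤ c +ℤ (a *ℤ d +ℤ e) ≡ a *ℤ (b *ℤ c +ℤ d) +ℤ e
  regroup = solve-∀

⊛-identityˡ : ∀ f → (oneS ⊛ f) ≈S f
⊛-identityˡ f zero    = ℤ.*-identityˡ (f 0)
⊛-identityˡ f (suc n) = begin
  (oneS ⊛ f) (suc n)                          ≡⟨ ⊛-suc oneS f n ⟩
  1ℤ *ℤ f (suc n) +ℤ (shift oneS ⊛ f) n       ≡⟨ cong₂ _+ℤ_ (ℤ.*-identityˡ (f (suc n)))
                                                   (sumUpTo-zero _ n (λ i → ℤ.*-zeroˡ (f (n ∸ i)))) ⟩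
  f (suc n) +ℤ 0ℤ                             ≡⟨ ℤ.+-identityʳ (f (suc n)) ⟩
  f (suc n)                                   ∎
  where open ≡-Reasoning

FPS-isCommutativeRing : IsCommutativeRing _⊕_ _⊛_ ⊝_ zeroS oneS
FPS-isCommutativeRing = record
  { isRing = record
    { +-isAbelianGroup = record
      { isGroup = record
        { isMonoid = record
          { isSemigroup = record
            { isMagma = record
              { isEquivalence = ≈S-isEquivalence
              ; ∙-cong = λ f≈f′ g≈g′ n → cong₂ _+ℤ_ (f≈f′ n) (g≈g′ n)
              }
            ; assoc = λ f g h n → ℤ.+-assoc (f n) (g n) (h n)
            }
          ; identity = (λ f n → ℤ.+-identityˡ (f n)) , (λ f n → ℤ.+-identityʳ (f n))
          }
        ; inverse = (λ f n → ℤ.+-inverseˡ (f n)) , (λ f n → ℤ.+-inverseʳ (f n))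
        ; ⁻¹-cong = λ f≈g n → cong ℤ.-_ (f≈g n)
        }
      ; comm = λ f g n → ℤ.+-comm (f n) (g n)
      }
    ; *-cong = ⊛-cong
    ; *-assoc = ⊛-assoc
    ; *-identity = ⊛-identityˡ , (λ f n → trans (⊛-comm f oneS n) (⊛-identityˡ f n))
    ; distrib = (λ h f g n → trans (⊛-comm h (f ⊕ g) n)
                               (trans (⊛-distribʳ h f g n) (cong₂ _+ℤ_ (⊛-comm f h n) (⊛-comm g h n))))
              , ⊛-distribʳ
    }
  ; *-comm = ⊛-comm
  }
  where
  ≈S-isEquivalence : IsEquivalence _≈S_
  ≈S-isEquivalence = record
    { refl = λ _ → refl ; sym = λ f≈g n → sym (f≈g n) ; trans = λ f≈g g≈h n → trans (f≈g n) (g≈h n) }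

FPS-commutativeRing : CommutativeRing 0ℓ 0ℓ
FPS-commutativeRing = record { isCommutativeRing = FPS-isCommutativeRing }

-- Sends 0ℤ and 1ℤ to zeroS and oneS on the nose, so that the solver's
-- con 0ℤ and con 1ℤ are definitionally the units used in Defs.
constant : ℤ → FPS
constant +0         n       = 0ℤ
constant +[1+ 0 ]   n       = oneS n
constant c          zero    = c
constant c          (suc n) = 0ℤ

constant-zero : ∀ c → constant c 0 ≡ c
constant-zero +0              = refl
constant-zero +[1+ 0 ]        = refl
constant-zero +[1+ suc m ]    = refl
constant-zero -[1+ m ]        = refl

constant-suc : ∀ c n → constant c (suc n) ≡ 0ℤ
constant-suc +0              n = refl
constant-suc +[1+ 0 ]        n = refl
constant-suc +[1+ suc m ]    n = refl
constant-suc -[1+ m ]        n = refl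

constant-+ : ∀ a b → constant (a +ℤ b) ≈S (constant a ⊕ constant b)
constant-+ a b zero    = trans (constant-zero (a +ℤ b)) (sym (cong₂ _+ℤ_ (constant-zero a) (constant-zero b)))
constant-+ a b (suc n) = trans (constant-suc (a +ℤ b) n) (sym (cong₂ _+ℤ_ (constant-suc a n) (constant-suc b n)))

constant-* : ∀ a b → constant (a *ℤ b) ≈S (constant a ⊛ constant b)
constant-* a b zero    = trans (constant-zero (a *ℤ b)) (sym (cong₂ _*ℤ_ (constant-zero a) (constant-zero b)))
constant-* a b (suc n) = trans (constant-suc (a *ℤ b) n) (sym (begin
  (constant a ⊛ constant b) (suc n)                                      ≡⟨ ⊛-suc (constant a) (constant b) n ⟩
  constant a 0 *ℤ constant b (suc n) +ℤ (shift (constant a) ⊛ constant b) n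
    ≡⟨ cong₂ _+ℤ_ (trans (cong (constant a 0 *ℤ_) (constant-suc b n)) (ℤ.*-zeroʳ (constant a 0)))
                  (sumUpTo-zero _ n (λ i → trans (cong (_*ℤ constant b (n ∸ i)) (constant-suc a i))
                                                 (ℤ.*-zeroˡ (constant b (n ∸ i))))) ⟩
  0ℤ +ℤ 0ℤ                                                               ∎))
  where open ≡-Reasoning

constant-neg : ∀ a → constant (ℤ.- a) ≈S (⊝ constant a)
constant-neg a zero    = trans (constant-zero (ℤ.- a)) (sym (cong ℤ.-_ (constant-zero a)))
constant-neg a (suc n) = trans (constant-suc (ℤ.- a) n) (sym (cong ℤ.-_ (constant-suc a n)))

constant-homomorphism : ℤ.+-*-rawRing -Raw-AlmostCommutative⟶ fromCommutativeRing FPS-commutativeRing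
constant-homomorphism = record
  { ⟦_⟧    = constant
  ; +-homo = constant-+
  ; *-homo = constant-*
  ; -‿homo = constant-neg
  ; 0-homo = λ _ → refl
  ; 1-homo = λ _ → refl
  }

constant-≟ : ∀ a b → Maybe (constant a ≈S constant b)
constant-≟ a b with a ℤ.≟ b
... | yes refl = just (λ _ → refl)
... | no _     = nothing

open RingSolver ℤ.+-*-rawRing (fromCommutativeRing FPS-commutativeRing) constant-homomorphism constant-≟
  using (solve; _:=_; _:+_; _:*_; :-_; _:^_; con)

module FPSRing = CommutativeRing FPS-commutativeRing
open import Algebra.Properties.CommutativeSemiring.Exp FPSRing.commutativeSemiring
  using (_^_; ^-distrib-*; ^-congˡ)

z : FPS
z = zpow 1

z⊛-zero : ∀ f → (z ⊛ f) 0 ≡ 0ℤ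
z⊛-zero f = ℤ.*-zeroˡ (f 0)

z⊛-suc : ∀ f n → (z ⊛ f) (suc n) ≡ f n
z⊛-suc f n = begin
  (z ⊛ f) (suc n)                    ≡⟨ ⊛-suc z f n ⟩
  0ℤ *ℤ f (suc n) +ℤ (shift z ⊛ f) n  ≡⟨ cong₂ _+ℤ_ (ℤ.*-zeroˡ (f (suc n))) (⊛-cong {g = f} shift-z≈1 (λ _ → refl) n) ⟩
  0ℤ +ℤ (oneS ⊛ f) n                  ≡⟨ ℤ.+-identityˡ _ ⟩
  (oneS ⊛ f) n                        ≡⟨ ⊛-identityˡ f n ⟩
  f n                                 ∎
  where
  open ≡-Reasoning
  shift-z≈1 : shift z ≈S oneS
  shift-z≈1 zero    = refl
  shift-z≈1 (suc m) = refl

zpow≈z^ : ∀ k → zpow k ≈S (z ^ k)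
zpow≈z^ zero    zero    = refl
zpow≈z^ zero    (suc n) = refl
zpow≈z^ (suc k) zero    = sym (z⊛-zero (z ^ k))
zpow≈z^ (suc k) (suc n) = trans (zpow≈z^ k n) (sym (z⊛-suc (z ^ k) n))

^S≈^ : ∀ f k → (f ^S k) ≈S (f ^ k)
^S≈^ f zero    = λ _ → refl
^S≈^ f (suc k) = ⊛-cong {f} {f} (λ _ → refl) (^S≈^ f k)

module Reciprocal (w : FPS) where

  history : ℕ → ℕ → ℤ
  history zero    _       = 1ℤ
  history (suc n) zero    = ℤ.- sumUpTo (λ i → w (suc i) *ℤ history n i) n
  history (suc n) (suc i) = history n i

  recip : FPS
  recip n = history n 0

  history≡recip : ∀ n i → i ≤ n → history n i ≡ recip (n ∸ i)
  history≡recip n       zero    _         = refl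
  history≡recip (suc n) (suc i) (s≤s i≤n) = history≡recip n i i≤n

  recip-suc : ∀ n → recip (suc n) ≡ ℤ.- (shift w ⊛ recip) n
  recip-suc n = cong ℤ.-_ (sumUpTo-cong-≤ n (λ i i≤n → cong (w (suc i) *ℤ_) (history≡recip n i i≤n)))

  ⊛-recip : w 0 ≡ 1ℤ → (w ⊛ recip) ≈S oneS
  ⊛-recip w₀≡1 zero    = cong (_*ℤ 1ℤ) w₀≡1
  ⊛-recip w₀≡1 (suc n) = begin
    (w ⊛ recip) (suc n)                          ≡⟨ ⊛-suc w recip n ⟩
    w 0 *ℤ recip (suc n) +ℤ (shift w ⊛ recip) n   ≡⟨ cong₂ (λ a b → a *ℤ b +ℤ (shift w ⊛ recip) n) w₀≡1 (recip-suc n) ⟩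
    1ℤ *ℤ ℤ.- (shift w ⊛ recip) n +ℤ (shift w ⊛ recip) n ≡⟨ cancel ((shift w ⊛ recip) n) ⟩
    0ℤ                                           ∎
    where
    open ≡-Reasoning
    cancel : ∀ a → 1ℤ *ℤ ℤ.- a +ℤ a ≡ 0ℤ
    cancel = solve-∀

infix 2 ∑-syntax

∑-syntax : ∀ {A : Set} → List A → (A → ℕ) → ℕ
∑-syntax xs f = sum (map f xs)

syntax ∑-syntax xs (λ x → e) = ∑[ x ∈ xs ] e

∑-cong : ∀ {A : Set} {f g : A → ℕ} xs → (∀ x → f x ≡ g x) → (∑[ x ∈ xs ] f x) ≡ (∑[ x ∈ xs ] g x)
∑-cong []       f≡g = refl
∑-cong (x ∷ xs) f≡g = cong₂ _+_ (f≡g x) (∑-cong xs f≡g)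

∑-+ : ∀ {A : Set} (f g : A → ℕ) xs → (∑[ x ∈ xs ] (f x + g x)) ≡ (∑[ x ∈ xs ] f x) + (∑[ x ∈ xs ] g x)
∑-+ f g []       = refl
∑-+ f g (x ∷ xs) = trans (cong (f x + g x +_) (∑-+ f g xs))
  (ℕ-+-interchange (f x) (g x) _ _)

∑-zero : ∀ {A : Set} (xs : List A) → (∑[ x ∈ xs ] 0) ≡ 0
∑-zero []       = refl
∑-zero (x ∷ xs) = ∑-zero xs

∑-swap : ∀ {A B : Set} (f : A → B → ℕ) xs ys →
         (∑[ x ∈ xs ] ∑[ y ∈ ys ] f x y) ≡ (∑[ y ∈ ys ] ∑[ x ∈ xs ] f x y)
∑-swap f []       ys = sym (∑-zero ys)
∑-swap f (x ∷ xs) ys = trans (cong ((∑[ y ∈ ys ] f x y) +_) (∑-swap f xs ys))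
  (sym (∑-+ (f x) (λ y → ∑[ x′ ∈ xs ] f x′ y) ys))

-- An automaton reading paths

-- afterD covers the empty path and every path ending in a D not preceded by U.
data Context : Set where
  afterU afterUD afterD afterL : Context

suffix : Context → List Step
suffix afterU  = U ∷ []
suffix afterUD = U ∷ D ∷ []
suffix afterD  = []
suffix afterL  = L ∷ []

Config : Set
Config = Context × ℕ

step : Step → Context → ℕ → Maybe Config
step U afterL  h       = nothing
step U _       h       = just (afterU , suc h)
step D _       zero    = nothing
step D afterU  (suc h) = just (afterUD , h)
step D _       (suc h) = just (afterD , h)
step L _       zero    = nothing
step L afterU  (suc h) = nothing
step L afterUD (suc h) = nothing
step L _       (suc h) = just (afterL , h)

next : Step → Maybe Config → Maybe Config
next x nothing        = nothing
next x (just (s , h)) = step x s h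

run : Maybe Config → List Step → Maybe Config
run c []      = c
run c (x ∷ w) = run (next x c) w

run-nothing : ∀ w → run nothing w ≡ nothing
run-nothing []      = refl
run-nothing (x ∷ w) = run-nothing w

run-∷ʳ : ∀ c w x → run c (w ∷ʳ x) ≡ next x (run c w)
run-∷ʳ c []      x = refl
run-∷ʳ c (y ∷ w) x = run-∷ʳ (next y c) w x

start : Maybe Config
start = just (afterD , 0)

accepted : Context → ℕ → ℕ → List Step → Bool
accepted s h k w =
  (stays≥0 h w ∧ noULLU (suffix s ++ w)) ∧ noUDL (suffix s ++ w) ∧ (endLevel h w ≡ᵇ k)

acceptedFrom : ℕ → Maybe Config → List Step → Bool
acceptedFrom k nothing        w = false
acceptedFrom k (just (s , h)) w = accepted s h k w

endsAt : ℕ → Maybe Config → Bool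
endsAt k nothing        = false
endsAt k (just (s , h)) = h ≡ᵇ k

accepted-∷ : ∀ x s h k w → accepted s h k (x ∷ w) ≡ acceptedFrom k (step x s h) w
accepted-∷ U afterU  h       k w = refl
accepted-∷ U afterUD h       k w = refl
accepted-∷ U afterD  h       k w = refl
accepted-∷ U afterL  h       k w = cong (λ b → b ∧ noUDL (L ∷ U ∷ w) ∧ (endLevel (suc h) w ≡ᵇ k))
                                        (∧-zeroʳ (stays≥0 (suc h) w))
accepted-∷ D s       zero    k w = refl
accepted-∷ D afterU  (suc h) k w = refl
accepted-∷ D afterUD (suc h) k w = refl
accepted-∷ D afterD  (suc h) k w = refl
accepted-∷ D afterL  (suc h) k w = refl
accepted-∷ L s       zero    k w = refl
accepted-∷ L afterU  (suc h) k w = cong (λ b → b ∧ noUDL (U ∷ L ∷ w) ∧ (endLevel h w ≡ᵇ k))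
                                        (∧-zeroʳ (stays≥0 h w))
accepted-∷ L afterUD (suc h) k w = ∧-zeroʳ (stays≥0 h w ∧ noULLU (L ∷ w))
accepted-∷ L afterD  (suc h) k w = refl
accepted-∷ L afterL  (suc h) k w = refl

accepted≡endsAt : ∀ s h k w → accepted s h k w ≡ endsAt k (run (just (s , h)) w)
accepted≡endsAt afterU  h k []      = refl
accepted≡endsAt afterUD h k []      = refl
accepted≡endsAt afterD  h k []      = refl
accepted≡endsAt afterL  h k []      = refl
accepted≡endsAt s       h k (x ∷ w) = trans (accepted-∷ x s h k w) (acceptedFrom≡endsAt (step x s h))
  where
  acceptedFrom≡endsAt : ∀ c → acceptedFrom k c w ≡ endsAt k (run c w)
  acceptedFrom≡endsAt nothing        = cong (endsAt k) (sym (run-nothing w))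
  acceptedFrom≡endsAt (just (t , m)) = accepted≡endsAt t m k w

indicator : Bool → ℕ
indicator true  = 1
indicator false = 0

index : Context → ℕ
index afterU  = 0
index afterUD = 1
index afterD  = 2
index afterL  = 3

contexts : List Context
contexts = afterU ∷ afterUD ∷ afterD ∷ afterL ∷ []

steps : List Step
steps = U ∷ D ∷ L ∷ []

hits : Config → Maybe Config → ℕ
hits c       nothing        = 0
hits (s , k) (just (t , h)) = indicator ((index s ≡ᵇ index t) ∧ (h ≡ᵇ k))

endsAt-split : ∀ k c → indicator (endsAt k c) ≡ (∑[ s ∈ contexts ] hits (s , k) c)
endsAt-split k nothing = refl
endsAt-split k (just (afterU  , h)) = sym (ℕ.+-identityʳ (indicator (h ≡ᵇ k)))
endsAt-split k (just (afterUD , h)) = sym (ℕ.+-identityʳ (indicator (h ≡ᵇ k)))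
endsAt-split k (just (afterD  , h)) = sym (ℕ.+-identityʳ (indicator (h ≡ᵇ k)))
endsAt-split k (just (afterL  , h)) = sym (ℕ.+-identityʳ (indicator (h ≡ᵇ k)))

predecessors : Context → ℕ → List Config
predecessors afterU  zero    = []
predecessors afterU  (suc k) = (afterU , k) ∷ (afterUD , k) ∷ (afterD , k) ∷ []
predecessors afterUD k       = (afterU , suc k) ∷ []
predecessors afterD  k       = (afterUD , suc k) ∷ (afterD , suc k) ∷ (afterL , suc k) ∷ []
predecessors afterL  k       = (afterD , suc k) ∷ (afterL , suc k) ∷ []

arrivals : ∀ s k c → (∑[ x ∈ steps ] hits (s , k) (next x c)) ≡ (∑[ p ∈ predecessors s k ] hits p c)
arrivals s       k       nothing           = sym (∑-zero (predecessors s k))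
arrivals afterU  zero    (just (afterU  , zero   )) = refl
arrivals afterU  zero    (just (afterU  , (suc h))) = refl
arrivals afterU  zero    (just (afterUD , zero   )) = refl
arrivals afterU  zero    (just (afterUD , (suc h))) = refl
arrivals afterU  zero    (just (afterD  , zero   )) = refl
arrivals afterU  zero    (just (afterD  , (suc h))) = refl
arrivals afterU  zero    (just (afterL  , zero   )) = refl
arrivals afterU  zero    (just (afterL  , (suc h))) = refl
arrivals afterU  (suc k) (just (afterU  , zero   )) = refl
arrivals afterU  (suc k) (just (afterU  , (suc h))) = refl
arrivals afterU  (suc k) (just (afterUD , zero   )) = refl
arrivals afterU  (suc k) (just (afterUD , (suc h))) = refl
arrivals afterU  (suc k) (just (afterD  , zero   )) = refl
arrivals afterU  (suc k) (just (afterD  , (suc h))) = refl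
arrivals afterU  (suc k) (just (afterL  , zero   )) = refl
arrivals afterU  (suc k) (just (afterL  , (suc h))) = refl
arrivals afterUD k       (just (afterU  , zero   )) = refl
arrivals afterUD k       (just (afterU  , (suc h))) = refl
arrivals afterUD k       (just (afterUD , zero   )) = refl
arrivals afterUD k       (just (afterUD , (suc h))) = refl
arrivals afterUD k       (just (afterD  , zero   )) = refl
arrivals afterUD k       (just (afterD  , (suc h))) = refl
arrivals afterUD k       (just (afterL  , zero   )) = refl
arrivals afterUD k       (just (afterL  , (suc h))) = refl
arrivals afterD  k       (just (afterU  , zero   )) = refl
arrivals afterD  k       (just (afterU  , (suc h))) = refl
arrivals afterD  k       (just (afterUD , zero   )) = refl
arrivals afterD  k       (just (afterUD , (suc h))) = refl
arrivals afterD  k       (just (afterD  , zero   )) = refl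
arrivals afterD  k       (just (afterD  , (suc h))) = refl
arrivals afterD  k       (just (afterL  , zero   )) = refl
arrivals afterD  k       (just (afterL  , (suc h))) = refl
arrivals afterL  k       (just (afterU  , zero   )) = refl
arrivals afterL  k       (just (afterU  , (suc h))) = refl
arrivals afterL  k       (just (afterUD , zero   )) = refl
arrivals afterL  k       (just (afterUD , (suc h))) = refl
arrivals afterL  k       (just (afterD  , zero   )) = refl
arrivals afterL  k       (just (afterD  , (suc h))) = refl
arrivals afterL  k       (just (afterL  , zero   )) = refl
arrivals afterL  k       (just (afterL  , (suc h))) = refl

∑-words-suc : ∀ (g : List Step → ℕ) n →
              (∑[ w ∈ words (suc n) ] g w) ≡ (∑[ w ∈ words n ] ∑[ x ∈ steps ] g (x ∷ w))
∑-words-suc g n = go (words n)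
  where
  go : ∀ ws → (∑[ w ∈ concatMap (λ w → (U ∷ w) ∷ (D ∷ w) ∷ (L ∷ w) ∷ []) ws ] g w)
            ≡ (∑[ w ∈ ws ] ∑[ x ∈ steps ] g (x ∷ w))
  go []       = refl
  go (w ∷ ws) = trans (regroup (g (U ∷ w)) (g (D ∷ w)) (g (L ∷ w)) _) (cong (_ +_) (go ws))
    where
    regroup : ∀ a b c r → a + (b + (c + r)) ≡ a + (b + (c + 0)) + r
    regroup = ℕ-Solver.solve-∀

∑-words-∷ʳ : ∀ (g : List Step → ℕ) n →
             (∑[ w ∈ words (suc n) ] g w) ≡ (∑[ w ∈ words n ] ∑[ x ∈ steps ] g (w ∷ʳ x))
∑-words-∷ʳ g zero    = sym (ℕ.+-identityʳ _)
∑-words-∷ʳ g (suc n) = begin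
  (∑[ w ∈ words (suc (suc n)) ] g w)                            ≡⟨ ∑-words-suc g (suc n) ⟩
  (∑[ w ∈ words (suc n) ] ∑[ x ∈ steps ] g (x ∷ w))              ≡⟨ ∑-words-∷ʳ (λ w → ∑[ x ∈ steps ] g (x ∷ w)) n ⟩
  (∑[ w ∈ words n ] ∑[ y ∈ steps ] ∑[ x ∈ steps ] g (x ∷ w ∷ʳ y)) ≡⟨ ∑-cong (words n) (λ w → ∑-swap (λ y x → g (x ∷ w ∷ʳ y)) steps steps) ⟩
  (∑[ w ∈ words n ] ∑[ x ∈ steps ] ∑[ y ∈ steps ] g (x ∷ w ∷ʳ y)) ≡⟨ ∑-words-suc (λ w → ∑[ y ∈ steps ] g (w ∷ʳ y)) n ⟨
  (∑[ w ∈ words (suc n) ] ∑[ y ∈ steps ] g (w ∷ʳ y))             ∎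
  where open ≡-Reasoning

count : Config → ℕ → ℕ
count c n = ∑[ w ∈ words n ] hits c (run start w)

count-suc : ∀ s k n → count (s , k) (suc n) ≡ (∑[ p ∈ predecessors s k ] count p n)
count-suc s k n = begin
  count (s , k) (suc n)                                                      ≡⟨ ∑-words-∷ʳ (λ w → hits (s , k) (run start w)) n ⟩
  (∑[ w ∈ words n ] ∑[ x ∈ steps ] hits (s , k) (run start (w ∷ʳ x)))         ≡⟨ ∑-cong (words n) (λ w → ∑-cong steps (λ x → cong (hits (s , k)) (run-∷ʳ start w x))) ⟩
  (∑[ w ∈ words n ] ∑[ x ∈ steps ] hits (s , k) (next x (run start w)))        ≡⟨ ∑-cong (words n) (λ w → arrivals s k (run start w)) ⟩
  (∑[ w ∈ words n ] ∑[ p ∈ predecessors s k ] hits p (run start w))            ≡⟨ ∑-swap (λ w p → hits p (run start w)) (words n) (predecessors s k) ⟩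
  (∑[ p ∈ predecessors s k ] count p n)                                       ∎
  where open ≡-Reasoning

length-filter≡∑indicator : ∀ {A : Set} (P : A → Bool) xs → length (filter (λ x → T? (P x)) xs) ≡ (∑[ x ∈ xs ] indicator (P x))
length-filter≡∑indicator P []       = refl
length-filter≡∑indicator P (x ∷ xs) with P x
... | true  = cong suc (length-filter≡∑indicator P xs)
... | false = length-filter≡∑indicator P xs

a≡∑count : ∀ k n → a k n ≡ (∑[ s ∈ contexts ] count (s , k) n)
a≡∑count k n = begin
  a k n                                                                ≡⟨ length-filter≡∑indicator (λ w → isSkewDyck w ∧ noUDL w ∧ (endLevel 0 w ≡ᵇ k)) (words n) ⟩
  (∑[ w ∈ words n ] indicator (accepted afterD 0 k w))                  ≡⟨ ∑-cong (words n) (λ w → cong indicator (accepted≡endsAt afterD 0 k w)) ⟩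
  (∑[ w ∈ words n ] indicator (endsAt k (run start w)))                 ≡⟨ ∑-cong (words n) (λ w → endsAt-split k (run start w)) ⟩
  (∑[ w ∈ words n ] ∑[ s ∈ contexts ] hits (s , k) (run start w))        ≡⟨ ∑-swap (λ w s → hits (s , k) (run start w)) (words n) contexts ⟩
  (∑[ s ∈ contexts ] count (s , k) n)                                   ∎
  where open ≡-Reasoning


-- The transfer equations

⨁ : List FPS → FPS
⨁ = foldr _⊕_ zeroS

⨁-coefficient : ∀ {A : Set} (F : A → FPS) (G : A → ℕ) n ps →
                (∀ p → F p n ≡ ℤ.+ G p) → ⨁ (map F ps) n ≡ ℤ.+ (∑[ p ∈ ps ] G p)
⨁-coefficient F G n []       F≡G = refl
⨁-coefficient F G n (p ∷ ps) F≡G =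
  trans (cong₂ _+ℤ_ (F≡G p) (⨁-coefficient F G n ps F≡G)) (sym (ℤ.pos-+ (G p) _))

δ : ℕ → FPS
δ zero    = oneS
δ (suc k) = zeroS

source : Context → ℕ → FPS
source afterD k = δ k
source _      _ = zeroS

source-zero : ∀ s k → source s k 0 ≡ ℤ.+ count (s , k) 0
source-zero afterU  k       = refl
source-zero afterUD k       = refl
source-zero afterD  zero    = refl
source-zero afterD  (suc k) = refl
source-zero afterL  k       = refl

source-suc : ∀ s k n → source s k (suc n) ≡ 0ℤ
source-suc afterU  k       n = refl
source-suc afterUD k       n = refl
source-suc afterD  zero    n = refl
source-suc afterD  (suc k) n = refl
source-suc afterL  k       n = refl

Solves : (Config → FPS) → Set
Solves F = ∀ s k → F (s , k) ≈S (source s k ⊕ z ⊛ ⨁ (map F (predecessors s k)))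

Solves⇒count : ∀ {F} → Solves F → ∀ s k n → F (s , k) n ≡ ℤ.+ count (s , k) n
Solves⇒count {F} F-solves s k zero = begin
  F (s , k) 0                                              ≡⟨ F-solves s k 0 ⟩
  source s k 0 +ℤ (z ⊛ ⨁ (map F (predecessors s k))) 0     ≡⟨ cong (source s k 0 +ℤ_) (z⊛-zero (⨁ (map F (predecessors s k)))) ⟩
  source s k 0 +ℤ 0ℤ                                       ≡⟨ ℤ.+-identityʳ _ ⟩
  source s k 0                                             ≡⟨ source-zero s k ⟩
  ℤ.+ count (s , k) 0                                      ∎
  where open ≡-Reasoning
Solves⇒count {F} F-solves s k (suc n) = begin
  F (s , k) (suc n)                                                    ≡⟨ F-solves s k (suc n) ⟩
  source s k (suc n) +ℤ (z ⊛ ⨁ (map F (predecessors s k))) (suc n)     ≡⟨ cong₂ _+ℤ_ (source-suc s k n) (z⊛-suc (⨁ (map F (predecessors s k))) n) ⟩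
  0ℤ +ℤ ⨁ (map F (predecessors s k)) n                                 ≡⟨ ℤ.+-identityˡ _ ⟩
  ⨁ (map F (predecessors s k)) n                                       ≡⟨ ⨁-coefficient F (λ p → count p n) n (predecessors s k)
                                                                            (λ (s′ , k′) → Solves⇒count F-solves s′ k′ n) ⟩
  ℤ.+ (∑[ p ∈ predecessors s k ] count p n)                            ≡⟨ cong ℤ.+_ (count-suc s k n) ⟨
  ℤ.+ count (s , k) (suc n)                                            ∎
  where open ≡-Reasoning

cubic : FPS → FPS → FPS
cubic z w = ⊝ (w ^ 2) ⊕ w ^ 3 ⊕ z ^ 2 ⊛ w ⊕ z ^ 2 ⊛ w ⊕ ⊝ (z ^ 2 ⊛ w ^ 2) ⊕ ⊝ (z ^ 4 ⊛ w) ⊕ ⊝ (z ^ 6)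

cubicW≈cubic : ∀ w → cubicW w ≈S cubic z w
cubicW≈cubic w n =
  cong₂ _+ℤ_ (cong₂ _+ℤ_ (cong₂ _+ℤ_ (cong₂ _+ℤ_ (cong ((⊝ (w ^S 2) ⊕ w ^S 3) n +ℤ_) (zpow⊛ 2 w)) (zpow⊛ 2 w))
    (cong ℤ.-_ (zpow⊛ 2 (w ^S 2)))) (cong ℤ.-_ (zpow⊛ 4 w))) (cong ℤ.-_ (zpow≈z^ 6 n))
  where
  zpow⊛ : ∀ k f → (zpow k ⊛ f) n ≡ (z ^ k ⊛ f) n
  zpow⊛ k f = ⊛-cong {g = f} (zpow≈z^ k) (λ _ → refl) n

relation : FPS → FPS → FPS
relation c d = d ⊕ ⊝ (c ⊛ (c ⊕ d ⊕ d ⊕ ⊝ (c ⊛ c)))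

keyCofactor : FPS → FPS → FPS → FPS
keyCofactor z y w = ⊝ (y ⊛ (w ⊛ y ⊕ oneS)) ⊕ (w ⊛ y) ^ 2 ⊕ w ⊛ y ⊕ oneS ⊕ z ^ 2 ⊛ y ^ 2 ⊕ z ^ 2 ⊛ y ^ 2
                    ⊕ ⊝ (z ^ 2 ⊛ y ⊛ (w ⊛ y ⊕ oneS)) ⊕ ⊝ (z ^ 4 ⊛ y ^ 2)

key-identity : ∀ z y w →
  let c = z ⊛ (z ⊛ y); d = y ⊕ ⊝ oneS ⊕ ⊝ c in
  relation c d
    ≈S (⊝ (y ^ 3) ⊛ cubic z w ⊕ keyCofactor z y w ⊛ (w ⊛ y ⊕ ⊝ oneS))
key-identity = solve 3 (λ z y w →
  let c = z :* (z :* y); d = y :+ :- con 1ℤ :+ :- c; one = con 1ℤ in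
  d :+ :- (c :* (c :+ d :+ d :+ :- (c :* c)))
    := :- (y :^ 3) :* (:- (w :^ 2) :+ w :^ 3 :+ z :^ 2 :* w :+ z :^ 2 :* w :+ :- (z :^ 2 :* w :^ 2)
                        :+ :- (z :^ 4 :* w) :+ :- (z :^ 6))
       :+ (:- (y :* (w :* y :+ one)) :+ (w :* y) :^ 2 :+ w :* y :+ one :+ z :^ 2 :* y :^ 2 :+ z :^ 2 :* y :^ 2
           :+ :- (z :^ 2 :* y :* (w :* y :+ one)) :+ :- (z :^ 4 :* y :^ 2)) :* (w :* y :+ :- one))
  (λ _ → refl)

totalCofactor : FPS → FPS → FPS
totalCofactor z y = oneS ⊕ ⊝ (z ^ 2 ⊛ y) ⊕ ⊝ (z ^ 2 ⊛ y) ⊕ z ^ 2 ⊕ z ^ 4 ⊛ y ⊕ z ^ 6 ⊛ y ^ 2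

total-identity : ∀ z y w →
  let c = z ⊛ (z ⊛ y); d = y ⊕ ⊝ oneS ⊕ ⊝ c in
  (z ^ 2 ⊛ (oneS ⊕ c ⊕ d ⊕ d ⊕ ⊝ (c ⊛ c)) ⊕ ⊝ (oneS ⊕ ⊝ w))
    ≈S (⊝ w ⊛ relation c d ⊕ totalCofactor z y ⊛ (w ⊛ y ⊕ ⊝ oneS))
total-identity = solve 3 (λ z y w →
  let c = z :* (z :* y); d = y :+ :- con 1ℤ :+ :- c; one = con 1ℤ in
  z :^ 2 :* (one :+ c :+ d :+ d :+ :- (c :* c)) :+ :- (one :+ :- w)
    := :- w :* (d :+ :- (c :* (c :+ d :+ d :+ :- (c :* c))))
       :+ (one :+ :- (z :^ 2 :* y) :+ :- (z :^ 2 :* y) :+ z :^ 2 :+ z :^ 4 :* y :+ z :^ 6 :* y :^ 2)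
          :* (w :* y :+ :- one))
  (λ _ → refl)

combination≈0 : ∀ {x a b p q} → x ≈S (a ⊛ p ⊕ b ⊛ q) → p ≈S zeroS → q ≈S zeroS → x ≈S zeroS
combination≈0 {x} {a} {b} {p} {q} x≈ p≈0 q≈0 = begin
  x                      ≈⟨ x≈ ⟩
  a ⊛ p ⊕ b ⊛ q          ≈⟨ +-cong (*-congˡ {a} p≈0) (*-congˡ {b} q≈0) ⟩
  a ⊛ zeroS ⊕ b ⊛ zeroS  ≈⟨ +-cong (zeroʳ a) (zeroʳ b) ⟩
  zeroS ⊕ zeroS          ≈⟨ +-identityʳ zeroS ⟩
  zeroS                  ∎
  where
  open FPSRing using (+-cong; *-congˡ; zeroʳ; +-identityʳ)
  open import Relation.Binary.Reasoning.Setoid FPSRing.setoid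

-- The explicit solution

module Solution (w : FPS) (w₀≡1 : w 0 ≡ 1ℤ) (cubicW≈0 : cubicW w ≈S zeroS) where

  open Reciprocal w using (recip; ⊛-recip)
  open FPSRing using (+-congʳ; *-congˡ; +-group)
  open import Algebra.Properties.Group +-group using (x∙y⁻¹≈ε⇒x≈y; x≈y⇒x∙y⁻¹≈ε)

  y v c d : FPS
  y = recip
  v = z ⊛ y
  c = z ⊛ v
  d = y ⊕ ⊝ oneS ⊕ ⊝ c

  relation≈0 : relation c d ≈S zeroS
  relation≈0 = combination≈0 {a = ⊝ (y ^ 3)} {b = keyCofactor z y w} (key-identity z y w)
    (λ n → trans (sym (cubicW≈cubic w n)) (cubicW≈0 n))
    (x≈y⇒x∙y⁻¹≈ε (⊛-recip w₀≡1))

  d-relation : d ≈S (c ⊛ (c ⊕ d ⊕ d ⊕ ⊝ (c ⊛ c)))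
  d-relation = x∙y⁻¹≈ε⇒x≈y d (c ⊛ (c ⊕ d ⊕ d ⊕ ⊝ (c ⊛ c))) relation≈0

  solution : Config → FPS
  solution (afterU  , k) = v ^ k ⊕ ⊝ δ k
  solution (afterUD , k) = v ^ k ⊛ c
  solution (afterD  , k) = v ^ k ⊛ d ⊕ δ k
  solution (afterL  , k) = v ^ k ⊛ (d ⊕ ⊝ (c ⊛ c))

  solution-solves : Solves solution
  solution-solves afterU zero = at-floor z
    where
    at-floor : ∀ z → (oneS ⊕ ⊝ oneS) ≈S (zeroS ⊕ z ⊛ zeroS)
    at-floor = solve 1 (λ z → con 1ℤ :+ :- con 1ℤ := con 0ℤ :+ z :* con 0ℤ) (λ _ → refl)
  solution-solves afterU (suc k) = up z y (v ^ k) (δ k)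
    where
    up : ∀ z y V D → let c = z ⊛ (z ⊛ y); d = y ⊕ ⊝ oneS ⊕ ⊝ c in
         ((z ⊛ y) ⊛ V ⊕ ⊝ zeroS) ≈S (zeroS ⊕ z ⊛ ((V ⊕ ⊝ D) ⊕ (V ⊛ c ⊕ ((V ⊛ d ⊕ D) ⊕ zeroS))))
    up = solve 4 (λ z y V D → let c = z :* (z :* y); d = y :+ :- con 1ℤ :+ :- c in
         (z :* y) :* V :+ :- con 0ℤ := con 0ℤ :+ z :* ((V :+ :- D) :+ (V :* c :+ ((V :* d :+ D) :+ con 0ℤ))))
         (λ _ → refl)
  solution-solves afterUD k = up-down z y (v ^ k)
    where
    up-down : ∀ z y V → (V ⊛ (z ⊛ (z ⊛ y))) ≈S (zeroS ⊕ z ⊛ (((z ⊛ y) ⊛ V ⊕ ⊝ zeroS) ⊕ zeroS))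
    up-down = solve 3 (λ z y V → V :* (z :* (z :* y)) := con 0ℤ :+ z :* (((z :* y) :* V :+ :- con 0ℤ) :+ con 0ℤ))
              (λ _ → refl)
  solution-solves afterD k = FPSRing.trans (+-congʳ {δ k} (*-congˡ {v ^ k} d-relation)) (down z v d (v ^ k) (δ k))
    where
    down : ∀ z v d V D → let c = z ⊛ v in
           (V ⊛ (c ⊛ (c ⊕ d ⊕ d ⊕ ⊝ (c ⊛ c))) ⊕ D)
             ≈S (D ⊕ z ⊛ ((v ⊛ V) ⊛ c ⊕ (((v ⊛ V) ⊛ d ⊕ zeroS) ⊕ ((v ⊛ V) ⊛ (d ⊕ ⊝ (c ⊛ c)) ⊕ zeroS))))
    down = solve 5 (λ z v d V D → let c = z :* v in
           V :* (c :* (c :+ d :+ d :+ :- (c :* c))) :+ D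
             := D :+ z :* ((v :* V) :* c :+ (((v :* V) :* d :+ con 0ℤ) :+ ((v :* V) :* (d :+ :- (c :* c)) :+ con 0ℤ))))
           (λ _ → refl)
  solution-solves afterL k = FPSRing.trans (*-congˡ {v ^ k} (+-congʳ {⊝ (c ⊛ c)} d-relation)) (left z v d (v ^ k))
    where
    left : ∀ z v d V → let c = z ⊛ v in
           (V ⊛ (c ⊛ (c ⊕ d ⊕ d ⊕ ⊝ (c ⊛ c)) ⊕ ⊝ (c ⊛ c)))
             ≈S (zeroS ⊕ z ⊛ (((v ⊛ V) ⊛ d ⊕ zeroS) ⊕ ((v ⊛ V) ⊛ (d ⊕ ⊝ (c ⊛ c)) ⊕ zeroS)))
    left = solve 4 (λ z v d V → let c = z :* v in
           V :* (c :* (c :+ d :+ d :+ :- (c :* c)) :+ :- (c :* c))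
             := con 0ℤ :+ z :* (((v :* V) :* d :+ con 0ℤ) :+ ((v :* V) :* (d :+ :- (c :* c)) :+ con 0ℤ)))
           (λ _ → refl)

  total : FPS
  total = oneS ⊕ c ⊕ d ⊕ d ⊕ ⊝ (c ⊛ c)

  A≈v^k⊛total : ∀ k → A k ≈S (v ^ k ⊛ total)
  A≈v^k⊛total k = FPSRing.trans A≈∑solution (sum-of-amplitudes c d (v ^ k) (δ k))
    where
    A≈∑solution : A k ≈S ⨁ (map (λ s → solution (s , k)) contexts)
    A≈∑solution n = trans (cong ℤ.+_ (a≡∑count k n))
      (sym (⨁-coefficient (λ s → solution (s , k)) (λ s → count (s , k) n) n contexts
                          (λ s → Solves⇒count solution-solves s k n)))
    sum-of-amplitudes : ∀ c d V D →
      ((V ⊕ ⊝ D) ⊕ (V ⊛ c ⊕ ((V ⊛ d ⊕ D) ⊕ (V ⊛ (d ⊕ ⊝ (c ⊛ c)) ⊕ zeroS))))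
        ≈S (V ⊛ (oneS ⊕ c ⊕ d ⊕ d ⊕ ⊝ (c ⊛ c)))
    sum-of-amplitudes = solve 4 (λ c d V D →
      (V :+ :- D) :+ (V :* c :+ ((V :* d :+ D) :+ (V :* (d :+ :- (c :* c)) :+ con 0ℤ)))
        := V :* (con 1ℤ :+ c :+ d :+ d :+ :- (c :* c)))
      (λ _ → refl)

  z²⊛total≈1-w : (z ^ 2 ⊛ total) ≈S (oneS ⊕ ⊝ w)
  z²⊛total≈1-w = x∙y⁻¹≈ε⇒x≈y (z ^ 2 ⊛ total) (oneS ⊕ ⊝ w)
    (combination≈0 {a = ⊝ w} {b = totalCofactor z y} (total-identity z y w) relation≈0
                   (x≈y⇒x∙y⁻¹≈ε (⊛-recip w₀≡1)))

  w⊛v≈z : (w ⊛ v) ≈S z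
  w⊛v≈z = FPSRing.trans (swap z w y) (FPSRing.trans (*-congˡ {z} (⊛-recip w₀≡1)) (FPSRing.*-identityʳ z))
    where
    swap : ∀ z w y → (w ⊛ (z ⊛ y)) ≈S (z ⊛ (w ⊛ y))
    swap = solve 3 (λ z w y → w :* (z :* y) := z :* (w :* y)) (λ _ → refl)

theorem1 : (w : FPS) → w 0 ≡ 1ℤ → cubicW w ≈S zeroS →
    (k : ℕ) → (zpow 2 ⊛ (w ^S k) ⊛ A k) ≈S (zpow k ⊛ (oneS ⊕ ⊝ w))
theorem1 w w₀≡1 cubicW≈0 k = begin
  zpow 2 ⊛ w ^S k ⊛ A k               ≈⟨ ⊛-cong (⊛-cong (zpow≈z^ 2) (^S≈^ w k)) (A≈v^k⊛total k) ⟩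
  z ^ 2 ⊛ w ^ k ⊛ (v ^ k ⊛ total)     ≈⟨ regroup z (w ^ k) (v ^ k) total ⟩
  (w ^ k ⊛ v ^ k) ⊛ (z ^ 2 ⊛ total)   ≈⟨ ⊛-cong (FPSRing.sym (^-distrib-* w v k)) z²⊛total≈1-w ⟩
  (w ⊛ v) ^ k ⊛ (oneS ⊕ ⊝ w)          ≈⟨ FPSRing.*-congʳ {oneS ⊕ ⊝ w} (^-congˡ k w⊛v≈z) ⟩
  z ^ k ⊛ (oneS ⊕ ⊝ w)                ≈⟨ FPSRing.*-congʳ {oneS ⊕ ⊝ w} (FPSRing.sym (zpow≈z^ k)) ⟩
  zpow k ⊛ (oneS ⊕ ⊝ w)               ∎
  where
  open Solution w w₀≡1 cubicW≈0
  open import Relation.Binary.Reasoning.Setoid FPSRing.setoid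
  regroup : ∀ z W V T → (z ^ 2 ⊛ W ⊛ (V ⊛ T)) ≈S ((W ⊛ V) ⊛ (z ^ 2 ⊛ T))
  regroup = solve 4 (λ z W V T → z :^ 2 :* W :* (V :* T) := (W :* V) :* (z :^ 2 :* T)) (λ _ → refl)
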